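{- Let $G$ be a finite, simple, connected $(n-3)$-regular graph of order $n\ge 5$. Then $\gamma_P(G)=1$ if and only if there exists an edge $uv\in E(G)$ such that $|N[v]\setminus N[u]|=1$.
   Context: Zero forcing: for $U\subseteq V(G)$ (black vertices), repeatedly apply the rule "if a black vertex has exactly one white neighbor, that neighbor becomes black"; the resulting set is the closure $cl(U)$. A set $S$ is a power dominating set if $cl(N[S])=V(G)$, where $N[S]$ is the closed neighborhood of $S$; $\gamma_P(G)$ is the minimum cardinality of a power dominating set. -}

module Defs where

open import Data.Nat using (ℕ; zero; suc; _∸_; _≥_; _≤_)
open import Data.Bool using (Bool; true; false; _∨_)
open import Data.Fin using (Fin; _≟_)
open import Relation.Nullary using (does)
open import Data.Fin.Subset using (Subset; _∈_; _─_; ∣_∣; inside; outside)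
open import Data.Vec using (tabulate)
open import Data.Product using (Σ; _×_; ∃; ∃-syntax)
open import Data.Sum using (_⊎_)
open import Relation.Binary.PropositionalEquality using (_≡_; _≢_)

record Graph (n : ℕ) : Set where
  field
    adj   : Fin n → Fin n → Bool
    sym   : ∀ u v → adj u v ≡ adj v u
    irrefl : ∀ v → adj v v ≡ false

module _ {n : ℕ} (G : Graph n) where
  open Graph G

  Adj : Fin n → Fin n → Set
  Adj u v = adj u v ≡ true

  nbhd : Fin n → Subset n
  nbhd v = tabulate (λ w → adj v w)

  degree : Fin n → ℕ
  degree v = ∣ nbhd v ∣

  Regular : ℕ → Set
  Regular k = ∀ v → degree v ≡ k

  data Walk : Fin n → Fin n → Set where
    nil  : ∀ {v} → Walk v v
    cons : ∀ {u v w} → Adj u v → Walk v w → Walk u w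

  Connected : Set
  Connected = ∀ u v → Walk u v

  closedNbhd : Fin n → Subset n
  closedNbhd v = tabulate (λ w → does (v ≟ w) ∨ adj v w)

  InClosedNbhd : Subset n → Fin n → Set
  InClosedNbhd S v = ∃[ s ] (s ∈ S × (s ≡ v ⊎ Adj s v))

  -- Zero forcing closure cl(U): the set of vertices that become black by
  -- repeatedly applying the forcing rule "a black vertex u with exactly one
  -- white neighbour v forces v to become black", starting from U.
  data InCl (U : Fin n → Set) : Fin n → Set where
    base  : ∀ {v} → U v → InCl U v
    force : ∀ {u v} → InCl U u → Adj u v →
            (∀ w → Adj u w → w ≢ v → InCl U w) → InCl U v

  IsPowerDominating : Subset n → Set
  IsPowerDominating S = ∀ v → InCl (InClosedNbhd S) v

  PowerDominationNumberIs : ℕ → Set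
  PowerDominationNumberIs k =
    (∃[ S ] (IsPowerDominating S × ∣ S ∣ ≡ k)) ×
    (∀ S → IsPowerDominating S → k ≤ ∣ S ∣)

-- In an (n−3)-regular graph every vertex s has exactly two non-neighbours x ≠ y.
-- If {s} is power dominating, some vertex w of N[s] is adjacent to exactly one of
-- them, say x: otherwise a black vertex adjacent to one of x, y is adjacent to
-- both and can never force, so x and y stay white.  Then N[w] ∖ N[s] = {x}.
-- Conversely, if N[v] ∖ N[u] = {c} for an edge uv, then N[u] misses only c and
-- one more vertex d ∉ N[v]; v forces c, after which any neighbour of d forces d.
module Submission where

open import Defs
open import Data.Nat using (ℕ; _≥_; _∸_)
open import Data.Fin using (Fin)
open import Data.Fin.Subset using (_─_; ∣_∣)
open import Data.Product using (_×_; ∃-syntax)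
open import Data.Sum using (_⊎_)
open import Function.Bundles using (_⇔_)
open import Relation.Binary.PropositionalEquality using (_≡_)

open import Data.Nat using (suc; _≤_; s≤s; z≤n)
open import Data.Nat.Properties using (suc-injective; m+n∸n≡m)
open import Data.Bool using (Bool; true; _∨_)
open import Data.Bool.Properties using (∨-zeroʳ) renaming (_≟_ to _≟ᵇ_)
open import Data.Fin using (zero; suc; _≟_)
open import Data.Fin.Subset using (Subset; _∈_; _∉_; _⊆_; _-_; ∁; ⁅_⁆; Nonempty; inside; outside)
open import Data.Fin.Subset.Properties
  using (_∈?_; x∈⁅x⁆; x∈⁅y⁆⇒x≡y; x∉⁅y⁆⇒x≢y; ∣⁅x⁆∣≡1; ⊆-antisym; p─⊥≡p; p─q⊆p;
         x∈p∧x∉q⇒x∈p─q; x∈p∧x≢y⇒x∈p-y; x∉p⇒x∈∁p; x∈∁p⇒x∉p; ∣∁p∣≡n∸∣p∣)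
open import Data.Vec using (_∷_; tabulate; here; there)
open import Data.Vec.Properties using (lookup∘tabulate; []=⇒lookup; lookup⇒[]=)
open import Data.Product using (_,_; proj₁; proj₂; map₂) renaming (map to map×)
open import Data.Sum using (inj₁; inj₂)
open import Function using (_∘_)
open import Function.Bundles using (mk⇔)
open import Relation.Nullary using (¬_; yes; no; does)
open import Relation.Nullary.Negation using (contradiction)
open import Relation.Nullary.Decidable using (dec-true)
open import Relation.Binary.PropositionalEquality using (_≢_; refl; sym; trans; cong; subst; module ≡-Reasoning)

private
  variable
    n : ℕ

∈-tabulate⁺ : ∀ {f : Fin n → Bool} {x} → f x ≡ true → x ∈ tabulate f
∈-tabulate⁺ {f = f} {x = x} fx = lookup⇒[]= x (tabulate f) (trans (lookup∘tabulate f x) fx)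

∈-tabulate⁻ : ∀ {f : Fin n → Bool} {x} → x ∈ tabulate f → f x ≡ true
∈-tabulate⁻ {f = f} {x = x} x∈ = trans (sym (lookup∘tabulate f x)) ([]=⇒lookup x∈)

x∈p─q⇒x∉q : ∀ {x : Fin n} (p q : Subset n) → x ∈ p ─ q → x ∉ q
x∈p─q⇒x∉q (_ ∷ p) (outside ∷ q) here       = λ ()
x∈p─q⇒x∉q (_ ∷ p) (_ ∷ q)       (there x∈) = λ { (there x∈q) → x∈p─q⇒x∉q p q x∈ x∈q }

x∈p⇒∣p∣≡1+∣p-x∣ : ∀ {x : Fin n} {p : Subset n} → x ∈ p → ∣ p ∣ ≡ suc ∣ p - x ∣
x∈p⇒∣p∣≡1+∣p-x∣ {p = inside ∷ p}  here       = cong (suc ∘ ∣_∣) (sym (p─⊥≡p p))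
x∈p⇒∣p∣≡1+∣p-x∣ {p = inside ∷ p}  (there x∈) = cong suc (x∈p⇒∣p∣≡1+∣p-x∣ x∈)
x∈p⇒∣p∣≡1+∣p-x∣ {p = outside ∷ p} (there x∈) = x∈p⇒∣p∣≡1+∣p-x∣ x∈

∣p∣≡0⇒x∉p : ∀ {x : Fin n} {p : Subset n} → ∣ p ∣ ≡ 0 → x ∉ p
∣p∣≡0⇒x∉p ∣p∣≡0 x∈p with () ← trans (sym (x∈p⇒∣p∣≡1+∣p-x∣ x∈p)) ∣p∣≡0

∣p∣≡suc⇒nonempty : ∀ {k} (p : Subset n) → ∣ p ∣ ≡ suc k → Nonempty p
∣p∣≡suc⇒nonempty (inside ∷ p)  _ = zero , here
∣p∣≡suc⇒nonempty (outside ∷ p) e = map× suc there (∣p∣≡suc⇒nonempty p e)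

∣p∣≡1⇒p≡⁅x⁆ : ∀ (p : Subset n) → ∣ p ∣ ≡ 1 → ∃[ x ] p ≡ ⁅ x ⁆
∣p∣≡1⇒p≡⁅x⁆ p ∣p∣≡1 = x , ⊆-antisym p⊆⁅x⁆ ⁅x⁆⊆p
  where
  x = proj₁ (∣p∣≡suc⇒nonempty p ∣p∣≡1)
  x∈p = proj₂ (∣p∣≡suc⇒nonempty p ∣p∣≡1)

  p⊆⁅x⁆ : p ⊆ ⁅ x ⁆
  p⊆⁅x⁆ {y} y∈p with y ≟ x
  ... | yes refl = x∈⁅x⁆ x
  ... | no y≢x   = contradiction (x∈p∧x≢y⇒x∈p-y y∈p y≢x)
                                 (∣p∣≡0⇒x∉p (suc-injective (trans (sym (x∈p⇒∣p∣≡1+∣p-x∣ x∈p)) ∣p∣≡1)))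

  ⁅x⁆⊆p : ⁅ x ⁆ ⊆ p
  ⁅x⁆⊆p y∈⁅x⁆ = subst (_∈ p) (sym (x∈⁅y⁆⇒x≡y x y∈⁅x⁆)) x∈p

∣p∣≡2⇒partner : ∀ {x : Fin n} (p : Subset n) → ∣ p ∣ ≡ 2 → x ∈ p →
                ∃[ y ] (y ≢ x × y ∈ p × (∀ {z} → z ∈ p → z ≡ x ⊎ z ≡ y))
∣p∣≡2⇒partner {x = x} p ∣p∣≡2 x∈p = y , x∉⁅y⁆⇒x≢y (x∈p─q⇒x∉q p ⁅ x ⁆ y∈p-x) , p─q⊆p p ⁅ x ⁆ y∈p-x , cover
  where
  p-x≡⁅y⁆ = ∣p∣≡1⇒p≡⁅x⁆ (p - x) (suc-injective (trans (sym (x∈p⇒∣p∣≡1+∣p-x∣ x∈p)) ∣p∣≡2))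
  y = proj₁ p-x≡⁅y⁆

  y∈p-x : y ∈ p - x
  y∈p-x = subst (y ∈_) (sym (proj₂ p-x≡⁅y⁆)) (x∈⁅x⁆ y)

  cover : ∀ {z} → z ∈ p → z ≡ x ⊎ z ≡ y
  cover {z} z∈p with z ≟ x
  ... | yes z≡x = inj₁ z≡x
  ... | no z≢x  = inj₂ (x∈⁅y⁆⇒x≡y y (subst (z ∈_) (proj₂ p-x≡⁅y⁆) (x∈p∧x≢y⇒x∈p-y z∈p z≢x)))

module _ {n : ℕ} (G : Graph n) where
  open Graph G using (adj)

  N[_] : Fin n → Subset n
  N[_] = closedNbhd G

  Observed : Subset n → Fin n → Set
  Observed S = InCl G (InClosedNbhd G S)

  -- N[v] ∖ N[u] = {c} says: once N[u] is observed, v forces c.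
  ForcingEdge : Fin n → Fin n → Set
  ForcingEdge u v = Adj G u v × ∣ N[ v ] ─ N[ u ] ∣ ≡ 1

  private
    variable
      u v w x : Fin n

  Adj-sym : Adj G u v → Adj G v u
  Adj-sym {u} {v} uv = trans (sym (Graph.sym G u v)) uv

  Adj-irrefl : ¬ Adj G v v
  Adj-irrefl {v} vv with () ← trans (sym vv) (Graph.irrefl G v)

  v∈N[v] : v ∈ N[ v ]
  v∈N[v] {v} = ∈-tabulate⁺ (cong (_∨ adj v v) (dec-true (v ≟ v) refl))

  Adj⇒∈N : Adj G v x → x ∈ N[ v ]
  Adj⇒∈N {v} {x} vx = ∈-tabulate⁺ (subst (λ b → does (v ≟ x) ∨ b ≡ true) (sym vx) (∨-zeroʳ _))

  ∈N⁻ : x ∈ N[ v ] → v ≡ x ⊎ Adj G v x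
  ∈N⁻ {x} {v} x∈ with v ≟ x | ∈-tabulate⁻ x∈
  ... | yes v≡x | _  = inj₁ v≡x
  ... | no _    | vx = inj₂ vx

  ∈N⇒InClosedNbhd⁅⁆ : x ∈ N[ u ] → InClosedNbhd G ⁅ u ⁆ x
  ∈N⇒InClosedNbhd⁅⁆ {u = u} x∈ = u , x∈⁅x⁆ u , ∈N⁻ x∈

  InClosedNbhd⁅⁆⇒∈N : InClosedNbhd G ⁅ u ⁆ x → x ∈ N[ u ]
  InClosedNbhd⁅⁆⇒∈N {u} (s , s∈⁅u⁆ , s≡x⊎sx) with refl ← x∈⁅y⁆⇒x≡y u s∈⁅u⁆ with s≡x⊎sx
  ... | inj₁ refl = v∈N[v]
  ... | inj₂ ux   = Adj⇒∈N ux

  observed⇒nonempty : ∀ {S} → Observed S v → Nonempty S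
  observed⇒nonempty (base (s , s∈S , _)) = s , s∈S
  observed⇒nonempty (force o _ _)        = observed⇒nonempty o

  powerDominating⁅⁆⇒γP≡1 : IsPowerDominating G ⁅ u ⁆ → PowerDominationNumberIs G 1
  powerDominating⁅⁆⇒γP≡1 {u} pd = (⁅ u ⁆ , pd , ∣⁅x⁆∣≡1 u) , 1≤∣S∣
    where
    1≤∣S∣ : ∀ S → IsPowerDominating G S → 1 ≤ ∣ S ∣
    1≤∣S∣ S pdS = subst (1 ≤_) (sym (x∈p⇒∣p∣≡1+∣p-x∣ (proj₂ (observed⇒nonempty (pdS u))))) (s≤s z≤n)

  γP≡1⇒powerDominating⁅⁆ : PowerDominationNumberIs G 1 → ∃[ s ] IsPowerDominating G ⁅ s ⁆
  γP≡1⇒powerDominating⁅⁆ ((S , pd , ∣S∣≡1) , _) with s , refl ← ∣p∣≡1⇒p≡⁅x⁆ S ∣S∣≡1 = s , pd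

  N[v]-v≡nbhd : N[ v ] - v ≡ nbhd G v
  N[v]-v≡nbhd {v} = ⊆-antisym ⊆nbhd nbhd⊆
    where
    ⊆nbhd : N[ v ] - v ⊆ nbhd G v
    ⊆nbhd x∈ with ∈N⁻ (p─q⊆p N[ v ] ⁅ v ⁆ x∈)
    ... | inj₁ refl = contradiction (x∈⁅x⁆ v) (x∈p─q⇒x∉q N[ v ] ⁅ v ⁆ x∈)
    ... | inj₂ vx   = ∈-tabulate⁺ vx

    nbhd⊆ : nbhd G v ⊆ N[ v ] - v
    nbhd⊆ x∈ = x∈p∧x≢y⇒x∈p-y (Adj⇒∈N vx) (λ { refl → Adj-irrefl vx })
      where vx = ∈-tabulate⁻ x∈

  regular⇒∣∁N[v]∣ : ∀ {k} → Regular G k → ∀ v → ∣ ∁ N[ v ] ∣ ≡ n ∸ suc k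
  regular⇒∣∁N[v]∣ {k} regular v = trans (∣∁p∣≡n∸∣p∣ N[ v ]) (cong (n ∸_) ∣N[v]∣≡1+k)
    where
    open ≡-Reasoning
    ∣N[v]∣≡1+k : ∣ N[ v ] ∣ ≡ suc k
    ∣N[v]∣≡1+k = begin
      ∣ N[ v ] ∣         ≡⟨ x∈p⇒∣p∣≡1+∣p-x∣ v∈N[v] ⟩
      suc ∣ N[ v ] - v ∣ ≡⟨ cong (suc ∘ ∣_∣) N[v]-v≡nbhd ⟩
      suc (degree G v)   ≡⟨ cong suc (regular v) ⟩
      suc k              ∎

  regular⇒neighbour : ∀ {k} → Regular G (suc k) → ∀ v → ∃[ w ] Adj G v w
  regular⇒neighbour regular v = map₂ ∈-tabulate⁻ (∣p∣≡suc⇒nonempty (nbhd G v) (regular v))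

  observedUnless⇒powerDominating : ∀ {S d} → (∀ v → ∃[ w ] Adj G v w) →
                                   (∀ {x} → x ≢ d → Observed S x) → IsPowerDominating G S
  observedUnless⇒powerDominating {d = d} neighbour observedUnless-d x with x ≟ d
  ... | no x≢d   = observedUnless-d x≢d
  ... | yes refl with y , dy ← neighbour d =
    force (observedUnless-d λ { refl → Adj-irrefl dy }) (Adj-sym dy) λ w _ → observedUnless-d

  module _ (twoNonNeighbours : ∀ v → ∣ ∁ N[ v ] ∣ ≡ 2) where

    nonNeighbourPartner : x ∉ N[ v ] →
                          ∃[ y ] (y ≢ x × y ∉ N[ v ] × (∀ {z} → z ∉ N[ v ] → z ≡ x ⊎ z ≡ y))
    nonNeighbourPartner {v = v} x∉ with y , y≢x , y∈∁ , cover ← ∣p∣≡2⇒partner (∁ N[ v ]) (twoNonNeighbours v) (x∉p⇒x∈∁p x∉)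
      = y , y≢x , x∈∁p⇒x∉p y∈∁ , cover ∘ x∉p⇒x∈∁p

    forcingEdge : ∀ {s x y} → x ∉ N[ s ] → (∀ {z} → z ∉ N[ s ] → z ≡ x ⊎ z ≡ y) →
                  w ∈ N[ s ] → Adj G w x → ¬ Adj G w y → ForcingEdge s w
    forcingEdge {w} {s} {x} x∉N[s] cover w∈N[s] wx ¬wy =
      s-w , trans (cong ∣_∣ N[w]─N[s]≡⁅x⁆) (∣⁅x⁆∣≡1 x)
      where
      s-w : Adj G s w
      s-w with ∈N⁻ w∈N[s]
      ... | inj₁ refl = contradiction (Adj⇒∈N wx) x∉N[s]
      ... | inj₂ sw   = sw

      ⊆⁅x⁆ : N[ w ] ─ N[ s ] ⊆ ⁅ x ⁆
      ⊆⁅x⁆ z∈ with cover (x∈p─q⇒x∉q N[ w ] N[ s ] z∈) | ∈N⁻ (p─q⊆p N[ w ] N[ s ] z∈)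
      ... | inj₁ refl | _         = x∈⁅x⁆ x
      ... | inj₂ refl | inj₁ refl = contradiction w∈N[s] (x∈p─q⇒x∉q N[ w ] N[ s ] z∈)
      ... | inj₂ refl | inj₂ wy   = contradiction wy ¬wy

      N[w]─N[s]≡⁅x⁆ : N[ w ] ─ N[ s ] ≡ ⁅ x ⁆
      N[w]─N[s]≡⁅x⁆ = ⊆-antisym ⊆⁅x⁆ λ z∈⁅x⁆ →
        subst (_∈ N[ w ] ─ N[ s ]) (sym (x∈⁅y⁆⇒x≡y x z∈⁅x⁆)) (x∈p∧x∉q⇒x∈p─q (Adj⇒∈N wx) x∉N[s])

    observedNonNeighbour⇒forcingEdge : ∀ {s} → Observed ⁅ s ⁆ x → x ∉ N[ s ] → ∃[ w ] ForcingEdge s w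
    observedNonNeighbour⇒forcingEdge (base x∈N[s]) x∉N[s] = contradiction (InClosedNbhd⁅⁆⇒∈N x∈N[s]) x∉N[s]
    observedNonNeighbour⇒forcingEdge {s = s} (force {u} u-obs ux others) x∉N[s] with u ∈? N[ s ]
    ... | no u∉N[s] = observedNonNeighbour⇒forcingEdge u-obs u∉N[s]
    ... | yes u∈N[s] with y , y≢x , y∉N[s] , cover ← nonNeighbourPartner x∉N[s] with adj u y ≟ᵇ true
    ...   | yes uy = observedNonNeighbour⇒forcingEdge (others y uy y≢x) y∉N[s]
    ...   | no ¬uy = u , forcingEdge x∉N[s] cover u∈N[s] ux ¬uy

    powerDominating⁅⁆⇒forcingEdge : ∀ {s} → IsPowerDominating G ⁅ s ⁆ → ∃[ u ] ∃[ v ] ForcingEdge u v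
    powerDominating⁅⁆⇒forcingEdge {s} pd with x , x∈∁N[s] ← ∣p∣≡suc⇒nonempty (∁ N[ s ]) (twoNonNeighbours s) =
      s , observedNonNeighbour⇒forcingEdge (pd x) (x∈∁p⇒x∉p x∈∁N[s])

    forcingEdge⇒powerDominating⁅⁆ : (∀ v → ∃[ w ] Adj G v w) → ForcingEdge u v → IsPowerDominating G ⁅ u ⁆
    forcingEdge⇒powerDominating⁅⁆ {u} {v} neighbour (uv , ∣N[v]─N[u]∣≡1) =
      observedUnless⇒powerDominating neighbour observedUnless-d
      where
      c = proj₁ (∣p∣≡1⇒p≡⁅x⁆ (N[ v ] ─ N[ u ]) ∣N[v]─N[u]∣≡1)
      N[v]─N[u]≡⁅c⁆ = proj₂ (∣p∣≡1⇒p≡⁅x⁆ (N[ v ] ─ N[ u ]) ∣N[v]─N[u]∣≡1)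

      c∈N[v]─N[u] : c ∈ N[ v ] ─ N[ u ]
      c∈N[v]─N[u] = subst (c ∈_) (sym N[v]─N[u]≡⁅c⁆) (x∈⁅x⁆ c)

      c∉N[u] : c ∉ N[ u ]
      c∉N[u] = x∈p─q⇒x∉q N[ v ] N[ u ] c∈N[v]─N[u]

      partner = nonNeighbourPartner c∉N[u]
      d = proj₁ partner
      d≢c = proj₁ (proj₂ partner)
      d∉N[u] = proj₁ (proj₂ (proj₂ partner))
      cover = proj₂ (proj₂ (proj₂ partner))

      d∉N[v] : d ∉ N[ v ]
      d∉N[v] d∈N[v] = d≢c (x∈⁅y⁆⇒x≡y c
        (subst (d ∈_) N[v]─N[u]≡⁅c⁆ (x∈p∧x∉q⇒x∈p─q d∈N[v] d∉N[u])))

      v-c : Adj G v c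
      v-c with ∈N⁻ (p─q⊆p N[ v ] N[ u ] c∈N[v]─N[u])
      ... | inj₁ v≡c  = contradiction (subst (_∈ N[ u ]) v≡c (Adj⇒∈N uv)) c∉N[u]
      ... | inj₂ vc   = vc

      observedUnless-c-d : x ≢ c → x ≢ d → Observed ⁅ u ⁆ x
      observedUnless-c-d {x} x≢c x≢d with x ∈? N[ u ]
      ... | yes x∈N[u] = base (∈N⇒InClosedNbhd⁅⁆ x∈N[u])
      ... | no x∉N[u] with cover x∉N[u]
      ...   | inj₁ x≡c = contradiction x≡c x≢c
      ...   | inj₂ x≡d = contradiction x≡d x≢d

      observed-c : Observed ⁅ u ⁆ c
      observed-c = force (base (∈N⇒InClosedNbhd⁅⁆ (Adj⇒∈N uv))) v-c
        λ w vw w≢c → observedUnless-c-d w≢c λ { refl → d∉N[v] (Adj⇒∈N vw) }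

      observedUnless-d : x ≢ d → Observed ⁅ u ⁆ x
      observedUnless-d {x} x≢d with x ≟ c
      ... | yes refl = observed-c
      ... | no x≢c   = observedUnless-c-d x≢c x≢d

mainTheorem8 : (n : ℕ) → (G : Graph n) → n ≥ 5 → Connected G → Regular G (n ∸ 3) →
    PowerDominationNumberIs G 1 ⇔
      (∃[ u ] ∃[ v ] (Adj G u v × ∣ closedNbhd G v ─ closedNbhd G u ∣ ≡ 1))
mainTheorem8 (suc (suc (suc (suc (suc m))))) G (s≤s (s≤s (s≤s (s≤s (s≤s _))))) _ regular =
  mk⇔ (λ γP≡1 → powerDominating⁅⁆⇒forcingEdge G twoNonNeighbours (proj₂ (γP≡1⇒powerDominating⁅⁆ G γP≡1)))
      (λ (_ , _ , uv) → powerDominating⁅⁆⇒γP≡1 G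
                          (forcingEdge⇒powerDominating⁅⁆ G twoNonNeighbours (regular⇒neighbour G regular) uv))
  where
  twoNonNeighbours : ∀ v → ∣ ∁ (closedNbhd G v) ∣ ≡ 2
  twoNonNeighbours v = trans (regular⇒∣∁N[v]∣ G regular v) (m+n∸n≡m 2 m)
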